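{- Let $(X,A,m,\alpha,r)$ be a reversible micro-macro system. (a) For non-empty subsets $a,b\subseteq X$, $|[\![a,b]\!]|=|[\![rb,ra]\!]|$, and hence $[\alpha]_{ab}=e^{S(b)-S(a)}[\alpha]_{rb,ra}$. (b) $(p,[\alpha^{ -1}])$ is the reversed Markov chain of $(p,[\alpha])$, i.e. $[\alpha^{ -1}]_{ab}=\frac{p_b}{p_a}[\alpha]_{ba}$ for $a,b\in A$. (c) The Markov chain $(p,[\alpha])$ is reversible if and only if $|[\![a,b]\!]|=|[\![b,a]\!]|$ for all $a,b\in A$. (d) If $r$ is invariant, then $(p,[\alpha])$ is reversible.
   Context: A micro-macro system $(X,A,m,\alpha)$ consists of finite sets $X$, $A$, a bijection $\alpha:X\to X$ and a surjection $m:X\to A$; identify $a\in A$ with $m^{ -1}(a)$. It is reversible with reversion $r:X\to X$ if $r^2=\mathrm{id}$ and $\alpha^{ -1}=r\alpha r$; $r$ is invariant if $mr=m$. For subsets $a,b\subseteq X$: $[\![a,b]\!]=\{i\in a:\alpha(i)\in b\}$, $[\alpha]_{ab}=|[\![a,b]\!]|/|a|$, $S(a)=\ln|a|$, $ra=r(a)$. $p_a=|a|/|X|$. $(p,[\alpha])$ denotes the Markov chain on $A$ with initial law $p$ and transition matrix $([\alpha]_{ab})_{a,b\in A}$; $[\alpha^{ -1}]$ is defined likewise with $\alpha^{ -1}$. The chain is reversible if $p_a[\alpha]_{ab}=p_b[\alpha]_{ba}$ for all $a,b$. -}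

module Defs where

open import Data.Nat using (ℕ; zero; suc)
open import Data.Integer using (+_)
open import Data.Bool using (_∧_)
open import Data.Product using (_×_; _,_)
open import Data.Fin using (Fin)
open import Data.Fin.Properties using (any?)
open import Data.Fin.Subset using (Subset)
open import Data.Fin.Subset.Properties using (_∈?_)
open import Data.Vec using (tabulate)
open import Data.Rational using (ℚ; 0ℚ; _/_; _*_; _÷_; ≢-nonZero)
open import Data.Rational.Properties using (_≟_)
import Data.Fin.Properties as FinP
open import Relation.Nullary using (does; yes; no)
open import Relation.Nullary.Decidable using (_×-dec_)
open import Relation.Binary.PropositionalEquality using (_≡_)

-- ratio p q = p / q as a rational; convention 0 if q = 0 (only ever used
-- with q ≠ 0 in the theorem, where it is the honest quotient)
ratio : ℕ → ℕ → ℚ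
ratio p zero    = 0ℚ
ratio p (suc q) = (+ p) / suc q

_÷₀_ : ℚ → ℚ → ℚ
p ÷₀ q with q ≟ 0ℚ
... | yes _   = 0ℚ
... | no q≢0  = _÷_ p q {{≢-nonZero q≢0}}

image : ∀ {n} → (Fin n → Fin n) → Subset n → Subset n
image f a = tabulate λ j → does (any? λ i → (i ∈? a) ×-dec (f i FinP.≟ j))

⟦_∣_,_⟧ : ∀ {n} → (Fin n → Fin n) → Subset n → Subset n → Subset n
⟦ f ∣ a , b ⟧ = tabulate λ i → does (i ∈? a) ∧ does (f i ∈? b)

open import Data.Fin.Subset using (∣_∣)
T : ∀ {n} → (Fin n → Fin n) → Subset n → Subset n → ℚ
T f a b = ratio ∣ ⟦ f ∣ a , b ⟧ ∣ ∣ a ∣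

-- macrostate x ∈ A identified with m⁻¹(x) ⊆ X
fiber : ∀ {n k} → (Fin n → Fin k) → Fin k → Subset n
fiber m x = tabulate λ i → does (m i FinP.≟ x)

prob : ∀ {n k} → (Fin n → Fin k) → Fin k → ℚ
prob {n} m x = ratio ∣ fiber m x ∣ n

macroT : ∀ {n k} → (Fin n → Fin n) → (Fin n → Fin k) → Fin k → Fin k → ℚ
macroT f m x y = T f (fiber m x) (fiber m y)

IsReversibleChain : ∀ {k} → (Fin k → ℚ) → (Fin k → Fin k → ℚ) → Set
IsReversibleChain p P = ∀ x y → p x * P x y ≡ p y * P y x

-- Everything reduces to counting. Since α⁻¹ = rαr, the map i ↦ r(α i) is an involution of X
-- carrying [[a,b]] bijectively onto [[rb,ra]], and α⁻¹ carries [[a,b]]_{α⁻¹} onto [[b,a]]_α.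
-- The probabilistic statements are then arithmetic on |[[a,b]]|/|a| together with
-- p_a [α]_{ab} = |[[a,b]]|/|X|. An invariant reversion fixes every macrostate, so for
-- macrostates (a) becomes the flow symmetry of (c), which gives (d).
module Submission where

open import Defs
open import Data.Bool using (_∧_; if_then_else_)
open import Data.Bool.Properties using (∧-comm)
open import Data.Nat as ℕ using (ℕ; zero; suc; NonZero; z≤n; >-nonZero)
import Data.Nat.Properties as ℕ
open import Data.Integer as ℤ using (+_)
import Data.Integer.Properties as ℤ
open import Data.Integer.Tactic.RingSolver using (solve-∀)
open import Data.Rational using (ℚ; 0ℚ; 1ℚ; _*_; 1/_; toℚᵘ; ≢-nonZero)
import Data.Rational.Properties as ℚ
import Data.Rational.Unnormalised as ℚᵘ
import Data.Rational.Unnormalised.Properties as ℚᵘ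
open import Data.Product using (_,_; _×_; ∃; proj₁)
open import Data.Fin using (Fin)
open import Data.Fin.Properties using (nonZeroIndex; any?) renaming (_≟_ to _≟ᶠ_)
open import Data.Fin.Subset using (Subset; Nonempty; ∣_∣; _∈_; inside; outside)
open import Data.Fin.Subset.Properties using (_∈?_; x∈p⇒∣p-x∣<∣p∣)
open import Data.Fin.Permutation as Perm using (Permutation′; _⟨$⟩ʳ_; _⟨$⟩ˡ_; permutation)
open import Data.Vec using ([]; _∷_; lookup; tabulate)
open import Data.Vec.Properties using (lookup∘tabulate; tabulate∘lookup; tabulate-cong; lookup⇒[]=)
open import Algebra.Properties.CommutativeMonoid.Sum ℕ.+-0-commutativeMonoid using (sum; sum-cong-≗; sum-permute)
open import Function.Definitions using (Surjective)
open import Function.Bundles using (_⇔_; mk⇔; Equivalence)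
open import Relation.Nullary using (Dec; yes; no; does; contradiction)
open import Relation.Nullary.Decidable using (dec-true; does-⇔; _×-dec_)
open import Relation.Binary.PropositionalEquality

private
  variable
    n k : ℕ

lookup-∈? : ∀ (p : Subset n) x → does (x ∈? p) ≡ lookup p x
lookup-∈? (inside  ∷ p) Fin.zero    = refl
lookup-∈? (outside ∷ p) Fin.zero    = refl
lookup-∈? (_       ∷ p) (Fin.suc x) = lookup-∈? p x

∣∣≡sum : ∀ (p : Subset n) → ∣ p ∣ ≡ sum (λ i → if lookup p i then 1 else 0)
∣∣≡sum []            = refl
∣∣≡sum (inside  ∷ p) = cong suc (∣∣≡sum p)
∣∣≡sum (outside ∷ p) = ∣∣≡sum p

∣∣-permute : ∀ (σ : Permutation′ n) (p q : Subset n) →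
             (∀ i → lookup p i ≡ lookup q (σ ⟨$⟩ʳ i)) → ∣ p ∣ ≡ ∣ q ∣
∣∣-permute σ p q p≗q∘σ = begin
  ∣ p ∣                                              ≡⟨ ∣∣≡sum p ⟩
  sum (λ i → if lookup p i then 1 else 0)            ≡⟨ sum-cong-≗ (λ i → cong (if_then 1 else 0) (p≗q∘σ i)) ⟩
  sum (λ i → if lookup q (σ ⟨$⟩ʳ i) then 1 else 0)   ≡⟨ sum-permute (λ i → if lookup q i then 1 else 0) σ ⟨
  sum (λ i → if lookup q i then 1 else 0)            ≡⟨ ∣∣≡sum q ⟨
  ∣ q ∣                                              ∎
  where open ≡-Reasoning

Nonempty⇒∣∣-nonZero : ∀ {p : Subset n} → Nonempty p → NonZero ∣ p ∣
Nonempty⇒∣∣-nonZero (x , x∈p) = >-nonZero (ℕ.≤-<-trans z≤n (x∈p⇒∣p-x∣<∣p∣ x∈p))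

lookup-⟦⟧ : ∀ (f : Fin n → Fin n) a b i → lookup ⟦ f ∣ a , b ⟧ i ≡ lookup a i ∧ lookup b (f i)
lookup-⟦⟧ f a b i = trans (lookup∘tabulate _ i) (cong₂ _∧_ (lookup-∈? a i) (lookup-∈? b (f i)))

module _ {f g : Fin n → Fin n} (g∘f≗id : ∀ i → g (f i) ≡ i) (f∘g≗id : ∀ j → f (g j) ≡ j) where

  lookup-image : ∀ b j → lookup (image f b) j ≡ lookup b (g j)
  lookup-image b j =
    trans (lookup∘tabulate _ j) (trans (does-⇔ j∈fb⇔gj∈b j∈fb? (g j ∈? b)) (lookup-∈? b (g j)))
    where
    j∈fb? : Dec (∃ λ i → i ∈ b × f i ≡ j)
    j∈fb? = any? λ i → (i ∈? b) ×-dec (f i ≟ᶠ j)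
    j∈fb⇔gj∈b : (∃ λ i → i ∈ b × f i ≡ j) ⇔ g j ∈ b
    j∈fb⇔gj∈b = mk⇔ (λ { (i , i∈b , refl) → subst (_∈ b) (sym (g∘f≗id i)) i∈b })
                    (λ gj∈b → g j , gj∈b , f∘g≗id j)

  ∣image∣ : ∀ b → ∣ image f b ∣ ≡ ∣ b ∣
  ∣image∣ b = sym (∣∣-permute (permutation f g f∘g≗id g∘f≗id) b (image f b)
                              (λ i → trans (cong (lookup b) (sym (g∘f≗id i))) (sym (lookup-image b (f i)))))

module _ {r : Fin n → Fin n} (r-involutive : ∀ i → r (r i) ≡ i) where

  image-invariant : ∀ b → (∀ j → lookup b (r j) ≡ lookup b j) → image r b ≡ b
  image-invariant b b∘r≗b = begin
    image r b                          ≡⟨ tabulate∘lookup (image r b) ⟨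
    tabulate (lookup (image r b))      ≡⟨ tabulate-cong (λ j → trans (lookup-image r-involutive r-involutive b j) (b∘r≗b j)) ⟩
    tabulate (lookup b)                ≡⟨ tabulate∘lookup b ⟩
    b                                  ∎
    where open ≡-Reasoning

∣⟦⟧∣-flip : ∀ (α : Permutation′ n) a b → ∣ ⟦ (α ⟨$⟩ˡ_) ∣ a , b ⟧ ∣ ≡ ∣ ⟦ (α ⟨$⟩ʳ_) ∣ b , a ⟧ ∣
∣⟦⟧∣-flip α a b = ∣∣-permute (Perm.flip α) ⟦ (α ⟨$⟩ˡ_) ∣ a , b ⟧ ⟦ (α ⟨$⟩ʳ_) ∣ b , a ⟧ λ i → begin
  lookup ⟦ (α ⟨$⟩ˡ_) ∣ a , b ⟧ i                  ≡⟨ lookup-⟦⟧ (α ⟨$⟩ˡ_) a b i ⟩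
  lookup a i ∧ lookup b (α ⟨$⟩ˡ i)                ≡⟨ ∧-comm (lookup a i) _ ⟩
  lookup b (α ⟨$⟩ˡ i) ∧ lookup a i                ≡⟨ cong (λ j → lookup b (α ⟨$⟩ˡ i) ∧ lookup a j) (Perm.inverseʳ α) ⟨
  lookup b (α ⟨$⟩ˡ i) ∧ lookup a (α ⟨$⟩ʳ (α ⟨$⟩ˡ i)) ≡⟨ lookup-⟦⟧ (α ⟨$⟩ʳ_) b a (α ⟨$⟩ˡ i) ⟨
  lookup ⟦ (α ⟨$⟩ʳ_) ∣ b , a ⟧ (α ⟨$⟩ˡ i)         ∎
  where open ≡-Reasoning

ratio-* : ∀ a b c .{{_ : NonZero b}} → ratio b a * ratio c b ≡ ratio c a
ratio-* zero    b       c = ℚ.*-zeroˡ (ratio c b)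
ratio-* (suc a) (suc b) c = ℚ.toℚᵘ-injective (begin
  toℚᵘ (ratio (suc b) (suc a) * ratio c (suc b))            ≈⟨ ℚ.toℚᵘ-homo-* (ratio (suc b) (suc a)) (ratio c (suc b)) ⟩
  toℚᵘ (ratio (suc b) (suc a)) ℚᵘ.* toℚᵘ (ratio c (suc b))  ≈⟨ ℚᵘ.*-cong (ℚ.toℚᵘ-fromℚᵘ (ℚᵘ.mkℚᵘ (+ suc b) a))
                                                                          (ℚ.toℚᵘ-fromℚᵘ (ℚᵘ.mkℚᵘ (+ c) b)) ⟩
  ℚᵘ.mkℚᵘ (+ suc b) a ℚᵘ.* ℚᵘ.mkℚᵘ (+ c) b                  ≈⟨ ℚᵘ.*≡* cross ⟩
  ℚᵘ.mkℚᵘ (+ c) a                                           ≈⟨ ℚ.toℚᵘ-fromℚᵘ (ℚᵘ.mkℚᵘ (+ c) a) ⟨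
  toℚᵘ (ratio c (suc a))                                    ∎)
  where
  open ℚᵘ.≃-Reasoning
  cross : (+ suc b ℤ.* + c) ℤ.* + suc a ≡ + c ℤ.* + (suc a ℕ.* suc b)
  cross = trans (rearrange (+ suc b) (+ c) (+ suc a)) (cong (+ c ℤ.*_) (sym (ℤ.pos-* (suc a) (suc b))))
    where
    rearrange : ∀ x y z → (x ℤ.* y) ℤ.* z ≡ y ℤ.* (z ℤ.* x)
    rearrange = solve-∀

ratio-injectiveˡ : ∀ {c d} n .{{_ : NonZero n}} → ratio c n ≡ ratio d n → c ≡ d
ratio-injectiveˡ {c} {d} (suc n) eq with ℚ.fromℚᵘ-injective {ℚᵘ.mkℚᵘ (+ c) n} {ℚᵘ.mkℚᵘ (+ d) n} eq
... | ℚᵘ.*≡* cross = ℤ.+-injective (ℤ.*-cancelʳ-≡ (+ c) (+ d) (+ suc n) cross)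

ratio≢0 : ∀ a n .{{_ : NonZero a}} .{{_ : NonZero n}} → ratio a n ≢ 0ℚ
ratio≢0 (suc a) (suc n) eq with ratio-injectiveˡ {suc a} {0} (suc n) (trans eq (sym (ℚ.0/n≡0 (suc n))))
... | ()

÷₀-unique : ∀ {p q s} → q ≢ 0ℚ → q * s ≡ p → p ÷₀ q ≡ s
÷₀-unique {p} {q} {s} q≢0 qs≡p with q ℚ.≟ 0ℚ
... | yes q≡0 = contradiction q≡0 q≢0
... | no  q≢0 = begin
  p * 1/q          ≡⟨ cong (_* 1/q) qs≡p ⟨
  (q * s) * 1/q    ≡⟨ cong (_* 1/q) (ℚ.*-comm q s) ⟩
  (s * q) * 1/q    ≡⟨ ℚ.*-assoc s q 1/q ⟩
  s * (q * 1/q)    ≡⟨ cong (s *_) (ℚ.*-inverseʳ q {{≢-nonZero q≢0}}) ⟩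
  s * 1ℚ           ≡⟨ ℚ.*-identityʳ s ⟩
  s                ∎
  where
  open ≡-Reasoning
  1/q : ℚ
  1/q = (1/ q) {{≢-nonZero q≢0}}

ratio-÷₀ : ∀ a b n .{{_ : NonZero a}} .{{_ : NonZero n}} → ratio b n ÷₀ ratio a n ≡ ratio b a
ratio-÷₀ a b n = ÷₀-unique (ratio≢0 a n) (ratio-* n a b)

module Reversible (α : Permutation′ n) (r : Fin n → Fin n)
                  (r-involutive : ∀ i → r (r i) ≡ i)
                  (α⁻¹≡rαr : ∀ i → α ⟨$⟩ˡ i ≡ r (α ⟨$⟩ʳ r i)) where

  rα-involutive : ∀ i → r (α ⟨$⟩ʳ r (α ⟨$⟩ʳ i)) ≡ i
  rα-involutive i = trans (sym (α⁻¹≡rαr (α ⟨$⟩ʳ i))) (Perm.inverseˡ α)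

  rα : Permutation′ n
  rα = permutation (λ i → r (α ⟨$⟩ʳ i)) (λ i → r (α ⟨$⟩ʳ i)) rα-involutive rα-involutive

  ∣⟦⟧∣-reverse : ∀ a b → ∣ ⟦ (α ⟨$⟩ʳ_) ∣ a , b ⟧ ∣ ≡ ∣ ⟦ (α ⟨$⟩ʳ_) ∣ image r b , image r a ⟧ ∣
  ∣⟦⟧∣-reverse a b = ∣∣-permute rα ⟦ (α ⟨$⟩ʳ_) ∣ a , b ⟧ ⟦ (α ⟨$⟩ʳ_) ∣ image r b , image r a ⟧ λ i → begin
    lookup ⟦ (α ⟨$⟩ʳ_) ∣ a , b ⟧ i                        ≡⟨ lookup-⟦⟧ (α ⟨$⟩ʳ_) a b i ⟩
    lookup a i ∧ lookup b (α ⟨$⟩ʳ i)                      ≡⟨ ∧-comm (lookup a i) _ ⟩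
    lookup b (α ⟨$⟩ʳ i) ∧ lookup a i                      ≡⟨ cong₂ (λ j k → lookup b j ∧ lookup a k)
                                                               (r-involutive (α ⟨$⟩ʳ i)) (rα-involutive i) ⟨
    lookup b (r (rα ⟨$⟩ʳ i)) ∧ lookup a (r (α ⟨$⟩ʳ (rα ⟨$⟩ʳ i)))
                                                          ≡⟨ cong₂ _∧_ (lookup-image r-involutive r-involutive b _)
                                                                       (lookup-image r-involutive r-involutive a _) ⟨
    lookup (image r b) (rα ⟨$⟩ʳ i) ∧ lookup (image r a) (α ⟨$⟩ʳ (rα ⟨$⟩ʳ i))
                                                          ≡⟨ lookup-⟦⟧ (α ⟨$⟩ʳ_) (image r b) (image r a) (rα ⟨$⟩ʳ i) ⟨
    lookup ⟦ (α ⟨$⟩ʳ_) ∣ image r b , image r a ⟧ (rα ⟨$⟩ʳ i) ∎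
    where open ≡-Reasoning

  T-reverse : ∀ a b → Nonempty b →
              T (α ⟨$⟩ʳ_) a b ≡ ratio ∣ b ∣ ∣ a ∣ * T (α ⟨$⟩ʳ_) (image r b) (image r a)
  T-reverse a b b≢∅ =
    trans (sym (ratio-* (∣ a ∣) ∣ b ∣ _ {{Nonempty⇒∣∣-nonZero b≢∅}}))
          (cong₂ (λ c d → ratio ∣ b ∣ ∣ a ∣ * ratio c d) (∣⟦⟧∣-reverse a b) (sym (∣image∣ r-involutive r-involutive b)))

  ∣⟦⟧∣-sym-on-invariant : ∀ a b → image r a ≡ a → image r b ≡ b →
                          ∣ ⟦ (α ⟨$⟩ʳ_) ∣ a , b ⟧ ∣ ≡ ∣ ⟦ (α ⟨$⟩ʳ_) ∣ b , a ⟧ ∣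
  ∣⟦⟧∣-sym-on-invariant a b ra≡a rb≡b =
    trans (∣⟦⟧∣-reverse a b) (cong₂ (λ c d → ∣ ⟦ (α ⟨$⟩ʳ_) ∣ c , d ⟧ ∣) rb≡b ra≡a)

fiber-invariant : ∀ {m : Fin n → Fin k} {r : Fin n → Fin n} → (∀ i → r (r i) ≡ i) →
                  (∀ i → m (r i) ≡ m i) → ∀ x → image r (fiber m x) ≡ fiber m x
fiber-invariant {m = m} {r} r-involutive m∘r≗m x = image-invariant r-involutive (fiber m x) λ j → begin
  lookup (fiber m x) (r j)   ≡⟨ lookup∘tabulate _ (r j) ⟩
  does (m (r j) ≟ᶠ x)        ≡⟨ cong (λ z → does (z ≟ᶠ x)) (m∘r≗m j) ⟩
  does (m j ≟ᶠ x)            ≡⟨ lookup∘tabulate _ j ⟨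
  lookup (fiber m x) j       ∎
  where open ≡-Reasoning

module _ {m : Fin n → Fin k} (m-surjective : Surjective _≡_ _≡_ m) where

  fiber-nonempty : ∀ x → Nonempty (fiber m x)
  fiber-nonempty x with m-surjective x
  ... | i , mi≡x = i , lookup⇒[]= i (fiber m x) (trans (lookup∘tabulate _ i) (dec-true (m i ≟ᶠ x) (mi≡x refl)))

  n-nonZero : Fin k → NonZero n
  n-nonZero x = nonZeroIndex (proj₁ (m-surjective x))

  ∣fiber∣-nonZero : ∀ x → NonZero ∣ fiber m x ∣
  ∣fiber∣-nonZero x = Nonempty⇒∣∣-nonZero (fiber-nonempty x)

  prob-*-macroT : ∀ f x y → prob m x * macroT f m x y ≡ ratio ∣ ⟦ f ∣ fiber m x , fiber m y ⟧ ∣ n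
  prob-*-macroT f x y = ratio-* n ∣ fiber m x ∣ _ {{∣fiber∣-nonZero x}}

  reversible⇔flow-symmetric : ∀ f → IsReversibleChain (prob m) (macroT f m) ⇔
                              (∀ x y → ∣ ⟦ f ∣ fiber m x , fiber m y ⟧ ∣ ≡ ∣ ⟦ f ∣ fiber m y , fiber m x ⟧ ∣)
  reversible⇔flow-symmetric f = mk⇔
    (λ balance x y → ratio-injectiveˡ n {{n-nonZero x}}
       (trans (sym (prob-*-macroT f x y)) (trans (balance x y) (prob-*-macroT f y x))))
    (λ symmetric x y → trans (prob-*-macroT f x y)
       (trans (cong (λ c → ratio c n) (symmetric x y)) (sym (prob-*-macroT f y x))))

  macroT-inverse : ∀ (α : Permutation′ n) x y →
                   macroT (α ⟨$⟩ˡ_) m x y ≡ (prob m y ÷₀ prob m x) * macroT (α ⟨$⟩ʳ_) m y x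
  macroT-inverse α x y =
    trans (cong (λ c → ratio c ∣ fiber m x ∣) (∣⟦⟧∣-flip α (fiber m x) (fiber m y)))
   (trans (sym (ratio-* (∣ fiber m x ∣) ∣ fiber m y ∣ _ {{∣fiber∣-nonZero y}}))
          (cong (_* macroT (α ⟨$⟩ʳ_) m y x)
                (sym (ratio-÷₀ (∣ fiber m x ∣) ∣ fiber m y ∣ n {{∣fiber∣-nonZero x}} {{n-nonZero x}}))))

theorem19 : ∀ {n k : ℕ} (α : Permutation′ n) (m : Fin n → Fin k) (r : Fin n → Fin n)
    → Surjective _≡_ _≡_ m
    → (∀ i → r (r i) ≡ i)
    → (∀ i → α ⟨$⟩ˡ i ≡ r (α ⟨$⟩ʳ r i))
    → ((∀ (a b : Subset n) → Nonempty a → Nonempty b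
          → (∣ ⟦ (α ⟨$⟩ʳ_) ∣ a , b ⟧ ∣ ≡ ∣ ⟦ (α ⟨$⟩ʳ_) ∣ image r b , image r a ⟧ ∣)
          × (T (α ⟨$⟩ʳ_) a b ≡ ratio ∣ b ∣ ∣ a ∣ * T (α ⟨$⟩ʳ_) (image r b) (image r a)))
      × (∀ (x y : Fin k) → macroT (α ⟨$⟩ˡ_) m x y ≡ (prob m y ÷₀ prob m x) * macroT (α ⟨$⟩ʳ_) m y x)
      × (IsReversibleChain (prob m) (macroT (α ⟨$⟩ʳ_) m)
          ⇔ (∀ (x y : Fin k) → ∣ ⟦ (α ⟨$⟩ʳ_) ∣ fiber m x , fiber m y ⟧ ∣ ≡ ∣ ⟦ (α ⟨$⟩ʳ_) ∣ fiber m y , fiber m x ⟧ ∣))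
      × ((∀ i → m (r i) ≡ m i) → IsReversibleChain (prob m) (macroT (α ⟨$⟩ʳ_) m)))
-- Nonemptiness of a is not needed: for |a| = 0 both sides of (a) are the junk value 0.
theorem19 α m r m-surjective r-involutive α⁻¹≡rαr =
    (λ a b _ b≢∅ → ∣⟦⟧∣-reverse a b , T-reverse a b b≢∅)
  , macroT-inverse m-surjective α
  , reversible⇔flow-symmetric m-surjective (α ⟨$⟩ʳ_)
  , λ m∘r≗m → Equivalence.from (reversible⇔flow-symmetric m-surjective (α ⟨$⟩ʳ_)) λ x y →
      ∣⟦⟧∣-sym-on-invariant (fiber m x) (fiber m y)
        (fiber-invariant r-involutive m∘r≗m x) (fiber-invariant r-involutive m∘r≗m y)
  where open Reversible α r r-involutive α⁻¹≡rαr
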